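{- Let $m\ge1$, $u_i>0$, $v_i>0$, $d_i:=u_i+v_i$ for $i=1,\dots,m$, $D:=\max_i d_i$, and $0<\delta<\frac12$ with $d_i\in[0,\delta D]\cup[(1-\delta)D,D]$ for every $i$. Let $p_z$ and $p_{z'}$ be two greedy patterns. If there is $k\in\{1,\dots,m\}$ such that (i) $d_k\ge(1-\delta)D$ and $z_k\ne z'_k$, and (ii) $p_z(k-1)\ge p_{z'}(k-1)$ and $p_z(k)\ge p_{z'}(k)$, then $p_z$ and $p_{z'}$ are $\frac12\delta D$-close, i.e., $|p_z(j)-p_{z'}(j)|\le\frac12\delta D$ for some $j\in\{0,1,\dots,m\}$.
   Context: A solution is $z=(z_1,\dots,z_m)$ with $z_i\in\{v_i,-u_i\}$; its pattern is $p_z(k)=p_z(0)+\sum_{i=1}^k z_i$ for $k=0,\dots,m$ (start point $p_z(0)$, end point $p_z(m)$). A forward greedy pattern has start point $p_z(0)\in[\frac14\delta D,(1-\frac14\delta)D]$ and, for $k=1,\dots,m$ in turn, $z_k\in\{v_k,-u_k\}$ is chosen such that $p_z(k)=p_z(k-1)+z_k\in[0,D]$ and, among such choices, $p_z(k)$ is as close as possible to $\frac12D$ (remaining ties broken arbitrarily). A backward greedy pattern has end point $p_z(m)\in[\frac14\delta D,(1-\frac14\delta)D]$ and, for $k=m,m-1,\dots,1$ in turn, $z_k\in\{v_k,-u_k\}$ is chosen and $p_z(k-1):=p_z(k)-z_k$ set so that $|p_z(k-1)-\frac12D|$ is minimal (ties broken arbitrarily). A greedy pattern is a forward or a backward greedy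 pattern. Two patterns $p,p'$ are $\varepsilon$-close if $|p(j)-p'(j)|\le\varepsilon$ for some $j\in\{0,\dots,m\}$.
   Formalization: The numbers $u_i$, $v_i$, the parameter $\delta$ and the start and end points of the greedy patterns are all rational. -}

module Defs where

open import Data.Nat using (ℕ; zero; suc; _∸_) renaming (_≤_ to _≤ℕ_)
open import Data.Integer using (+_)
open import Data.Rational using (ℚ; 0ℚ; 1ℚ; ½; _+_; _-_; -_; _*_; _/_; _≤_; _⊔_; ∣_∣)
open import Data.Product using (_×_; ∃)
open import Data.Sum using (_⊎_)
open import Relation.Binary.PropositionalEquality using (_≡_)

¼ : ℚ
¼ = + 1 / 4

-- Instances are given by sequences u v : ℕ → ℚ; only indices 1..m matter.
d : (u v : ℕ → ℚ) → ℕ → ℚ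
d u v i = u i + v i

-- dmax n = max_{1 ≤ i ≤ n} d_i  (with the convention dmax 0 = 0; only used for m ≥ 1,
-- where all d_i > 0, so this is exactly the maximum)
dmax : (u v : ℕ → ℚ) → ℕ → ℚ
dmax u v zero = 0ℚ
dmax u v (suc n) = dmax u v n ⊔ d u v (suc n)

_∈[_,_] : ℚ → ℚ → ℚ → Set
x ∈[ a , b ] = (a ≤ x) × (x ≤ b)

IsSolution : ℕ → (u v : ℕ → ℚ) → (ℕ → ℚ) → Set
IsSolution m u v z = ∀ i → 1 ≤ℕ i → i ≤ℕ m → (z i ≡ v i) ⊎ (z i ≡ - u i)

pat : ℚ → (ℕ → ℚ) → ℕ → ℚ
pat s z zero = s
pat s z (suc k) = pat s z k + z (suc k)

-- forward greedy pattern (start point s, steps z), with D the given value of max d_i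
IsForwardGreedy : ℕ → (u v : ℕ → ℚ) → (D δ : ℚ) → ℚ → (ℕ → ℚ) → Set
IsForwardGreedy m u v D δ s z =
  IsSolution m u v z ×
  (s ∈[ ¼ * δ * D , (1ℚ - ¼ * δ) * D ]) ×
  (∀ k → 1 ≤ℕ k → k ≤ℕ m →
     (pat s z k ∈[ 0ℚ , D ]) ×
     (∀ w → (w ≡ v k) ⊎ (w ≡ - u k) → (pat s z (k ∸ 1) + w) ∈[ 0ℚ , D ] →
        ∣ pat s z k - ½ * D ∣ ≤ ∣ (pat s z (k ∸ 1) + w) - ½ * D ∣))

IsBackwardGreedy : ℕ → (u v : ℕ → ℚ) → (D δ : ℚ) → ℚ → (ℕ → ℚ) → Set
IsBackwardGreedy m u v D δ s z =
  IsSolution m u v z ×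
  (pat s z m ∈[ ¼ * δ * D , (1ℚ - ¼ * δ) * D ]) ×
  (∀ k → 1 ≤ℕ k → k ≤ℕ m →
     ∀ w → (w ≡ v k) ⊎ (w ≡ - u k) →
        ∣ pat s z (k ∸ 1) - ½ * D ∣ ≤ ∣ (pat s z k - w) - ½ * D ∣)

IsGreedy : ℕ → (u v : ℕ → ℚ) → (D δ : ℚ) → ℚ → (ℕ → ℚ) → Set
IsGreedy m u v D δ s z = IsForwardGreedy m u v D δ s z ⊎ IsBackwardGreedy m u v D δ s z

Close : ℕ → ℚ → (ℕ → ℚ) → (ℕ → ℚ) → Set
Close m ε p p' = ∃ λ j → (j ≤ℕ m) × (∣ p j - p' j ∣ ≤ ε)

-- Write Δ(j) = p_z(j) - p_z'(j) and ε = δD/2.  Choosing the candidate nearer to D/2 puts the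
-- midpoint of the two candidates on the chosen side of D/2; together with p(j) ∈ [0, D] this
-- bounds Δ by ε at k - 1 (if z_k = v) or at k (if z_k = -u), since d_k ≥ (1 - δ)D, unless both
-- patterns are backward, resp. both forward.  In those two cases Δ ≤ ε fails only if Δ > D - ε
-- at the neighbouring index, and such a large gap persists step by step towards the endpoint
-- where both patterns are pinned to [δD/4, (1 - δ/4)D] — unless the patterns cross on the way,
-- which makes them ε-close.  At that endpoint Δ ≤ D - ε, a contradiction.

module Submission where

open import Defs
open import Data.List using (_∷_; [])
open import Data.Nat using (ℕ; zero; suc; _∸_; s≤s; z≤n; _≤‴_; ≤‴-refl; ≤‴-step) renaming (_≤_ to _≤ℕ_)
import Data.Nat.Properties as ℕ
open import Data.Rational using (ℚ; 0ℚ; 1ℚ; ½; _+_; _-_; -_; _*_; _≤_; _<_; ∣_∣; nonNegative)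
import Data.Rational.Properties as ℚ
open import Data.Product using (_×_; _,_; proj₁; proj₂)
open import Data.Sum using (_⊎_; inj₁; inj₂)
open import Data.Empty using (⊥-elim)
open import Function using (_∘_)
open import Relation.Nullary using (¬_; yes; no)
open import Relation.Nullary.Decidable using (dec⇒maybe)
open import Relation.Binary.PropositionalEquality
  using (_≡_; _≢_; refl; sym; trans; subst; subst₂; cong; module ≡-Reasoning)
open import Tactic.RingSolver using (solve)
open import Tactic.RingSolver.Core.AlmostCommutativeRing using (AlmostCommutativeRing; fromCommutativeRing)

ℚ-ring : AlmostCommutativeRing _ _
ℚ-ring = fromCommutativeRing ℚ.+-*-commutativeRing (λ x → dec⇒maybe (0ℚ ℚ.≟ x))

private variable
  x y c t D : ℚ

≤⇒0≤- : x ≤ y → 0ℚ ≤ y - x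
≤⇒0≤- {x} {y} x≤y = subst (_≤ y - x) (ℚ.+-inverseʳ x) (ℚ.+-monoˡ-≤ (- x) x≤y)

<⇒0<- : x < y → 0ℚ < y - x
<⇒0<- {x} {y} x<y = subst (_< y - x) (ℚ.+-inverseʳ x) (ℚ.+-monoˡ-< (- x) x<y)

y-x+x≡y : ∀ x y → (y - x) + x ≡ y
y-x+x≡y x y = solve (x ∷ y ∷ []) ℚ-ring

-- Linear inequalities are proved by exhibiting y - x as a sum of nonnegative slacks; the ring
-- solver checks the identity.
≤-by-slack : ∀ {t x y} → 0ℚ ≤ t → t ≡ y - x → x ≤ y
≤-by-slack {x = x} {y} 0≤t refl =
  subst₂ _≤_ (ℚ.+-identityˡ x) (y-x+x≡y x y) (ℚ.+-monoˡ-≤ x 0≤t)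

<-by-slack : ∀ {t x y} → 0ℚ < t → t ≡ y - x → x < y
<-by-slack {x = x} {y} 0<t refl =
  subst₂ _<_ (ℚ.+-identityˡ x) (y-x+x≡y x y) (ℚ.+-monoˡ-< x 0<t)

0≤+ : 0ℚ ≤ x → 0ℚ ≤ y → 0ℚ ≤ x + y
0≤+ = ℚ.+-mono-≤

0<+ : 0ℚ < x → 0ℚ ≤ y → 0ℚ < x + y
0<+ = ℚ.+-mono-<-≤

0≤* : ∀ {x y} → 0ℚ ≤ x → 0ℚ ≤ y → 0ℚ ≤ x * y
0≤* {x} {y} 0≤x 0≤y =
  ℚ.nonNegative⁻¹ (x * y) {{ℚ.nonNeg*nonNeg⇒nonNeg x {{nonNegative 0≤x}} y {{nonNegative 0≤y}}}}

<⇒≱ : ∀ {x y} → x < y → ¬ (y ≤ x)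
<⇒≱ x<y y≤x = ℚ.<-irrefl refl (ℚ.<-≤-trans x<y y≤x)

0≤x+x⇒0≤x : 0ℚ ≤ x + x → 0ℚ ≤ x
0≤x+x⇒0≤x {x} 0≤x+x with ℚ.≤-total 0ℚ x
... | inj₁ 0≤x = 0≤x
... | inj₂ x≤0 = ℚ.≤-trans 0≤x+x (subst (x + x ≤_) (ℚ.+-identityʳ x) (ℚ.+-monoʳ-≤ x x≤0))

≤-by-double-slack : 0ℚ ≤ t → t ≡ (y - x) + (y - x) → x ≤ y
≤-by-double-slack 0≤t refl = ≤-by-slack (0≤x+x⇒0≤x 0≤t) refl

∣x-c∣≡x-c : c ≤ x → ∣ x - c ∣ ≡ x - c
∣x-c∣≡x-c = ℚ.0≤p⇒∣p∣≡p ∘ ≤⇒0≤-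

∣x-c∣≡c-x : x ≤ c → ∣ x - c ∣ ≡ c - x
∣x-c∣≡c-x {x} {c} x≤c = begin
  ∣ x - c ∣     ≡⟨ cong ∣_∣ (solve (x ∷ c ∷ []) ℚ-ring) ⟩
  ∣ - (c - x) ∣ ≡⟨ ℚ.∣-p∣≡∣p∣ (c - x) ⟩
  ∣ c - x ∣     ≡⟨ ∣x-c∣≡x-c x≤c ⟩
  c - x         ∎
  where open ≡-Reasoning

upper-nearer⇒x+y≤c+c : x < y → ∣ y - c ∣ ≤ ∣ x - c ∣ → x + y ≤ c + c
upper-nearer⇒x+y≤c+c {x} {y} {c} x<y nearer with ℚ.≤-total x c | ℚ.≤-total y c
... | inj₁ x≤c | inj₁ y≤c = ℚ.+-mono-≤ x≤c y≤c
... | inj₁ x≤c | inj₂ c≤y =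
  ≤-by-slack (≤⇒0≤- (subst₂ _≤_ (∣x-c∣≡x-c c≤y) (∣x-c∣≡c-x x≤c) nearer)) (solve (x ∷ y ∷ c ∷ []) ℚ-ring)
... | inj₂ c≤x | _ = ⊥-elim (<⇒≱ x<y (≤-by-slack (≤⇒0≤- y-c≤x-c) (solve (x ∷ y ∷ c ∷ []) ℚ-ring)))
  where
  y-c≤x-c : y - c ≤ x - c
  y-c≤x-c = subst₂ _≤_ (∣x-c∣≡x-c (ℚ.≤-trans c≤x (ℚ.<⇒≤ x<y))) (∣x-c∣≡x-c c≤x) nearer

lower-nearer⇒c+c≤x+y : x < y → ∣ x - c ∣ ≤ ∣ y - c ∣ → c + c ≤ x + y
lower-nearer⇒c+c≤x+y {x} {y} {c} x<y nearer with ℚ.≤-total c x | ℚ.≤-total c y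
... | inj₁ c≤x | inj₁ c≤y = ℚ.+-mono-≤ c≤x c≤y
... | inj₂ x≤c | inj₁ c≤y =
  ≤-by-slack (≤⇒0≤- (subst₂ _≤_ (∣x-c∣≡c-x x≤c) (∣x-c∣≡x-c c≤y) nearer)) (solve (x ∷ y ∷ c ∷ []) ℚ-ring)
... | _ | inj₂ y≤c = ⊥-elim (<⇒≱ x<y (≤-by-slack (≤⇒0≤- c-x≤c-y) (solve (x ∷ y ∷ c ∷ []) ℚ-ring)))
  where
  c-x≤c-y : c - x ≤ c - y
  c-x≤c-y = subst₂ _≤_ (∣x-c∣≡c-x (ℚ.≤-trans (ℚ.<⇒≤ x<y) y≤c)) (∣x-c∣≡c-x y≤c) nearer

½D+½D≡D : ∀ D → ½ * D + ½ * D ≡ D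
½D+½D≡D D = solve (D ∷ []) ℚ-ring

upper-chosen⇒x+y≤D : x < y → y ∈[ 0ℚ , D ] →
                     (x ∈[ 0ℚ , D ] → ∣ y - ½ * D ∣ ≤ ∣ x - ½ * D ∣) → x + y ≤ D
upper-chosen⇒x+y≤D {x} {y} {D} x<y (_ , y≤D) nearer with ℚ.≤-total 0ℚ x
... | inj₁ 0≤x = subst (x + y ≤_) (½D+½D≡D D)
                   (upper-nearer⇒x+y≤c+c x<y (nearer (0≤x , ℚ.≤-trans (ℚ.<⇒≤ x<y) y≤D)))
... | inj₂ x≤0 = subst (x + y ≤_) (ℚ.+-identityˡ D) (ℚ.+-mono-≤ x≤0 y≤D)

lower-chosen⇒D≤x+y : x < y → x ∈[ 0ℚ , D ] →
                     (y ∈[ 0ℚ , D ] → ∣ x - ½ * D ∣ ≤ ∣ y - ½ * D ∣) → D ≤ x + y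
lower-chosen⇒D≤x+y {x} {y} {D} x<y (0≤x , _) nearer with ℚ.≤-total y D
... | inj₁ y≤D = subst (_≤ x + y) (½D+½D≡D D)
                   (lower-nearer⇒c+c≤x+y x<y (nearer (ℚ.≤-trans 0≤x (ℚ.<⇒≤ x<y) , y≤D)))
... | inj₂ D≤y = subst (_≤ x + y) (ℚ.+-identityˡ D) (ℚ.+-mono-≤ 0≤x D≤y)

x-p<x+q : ∀ {x p q} → 0ℚ < p → 0ℚ < q → x - p < x + q
x-p<x+q {x} {p} {q} 0<p 0<q = <-by-slack (0<+ 0<p (ℚ.<⇒≤ 0<q)) (solve (x ∷ p ∷ q ∷ []) ℚ-ring)

x<x+q-[-p] : ∀ {x p q} → 0ℚ < p → 0ℚ < q → x < (x + q) - - p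
x<x+q-[-p] {x} {p} {q} 0<p 0<q = <-by-slack (0<+ 0<p (ℚ.<⇒≤ 0<q)) (solve (x ∷ p ∷ q ∷ []) ℚ-ring)

x-p-q<x : ∀ {x p q} → 0ℚ < p → 0ℚ < q → (x - p) - q < x
x-p-q<x {x} {p} {q} 0<p 0<q = <-by-slack (0<+ 0<p (ℚ.<⇒≤ 0<q)) (solve (x ∷ p ∷ q ∷ []) ℚ-ring)

[x+w]-[y+w]≡x-y : ∀ x y w → (x + w) - (y + w) ≡ x - y
[x+w]-[y+w]≡x-y x y w = solve (x ∷ y ∷ w ∷ []) ℚ-ring

<-gap-down-up : ∀ {c} x y p q → c < (x - p) - (y + q) → 0ℚ ≤ p + q → c < x - y
<-gap-down-up {c} x y p q c<gap 0≤p+q =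
  <-by-slack (0<+ (<⇒0<- c<gap) 0≤p+q) (solve (c ∷ x ∷ y ∷ p ∷ q ∷ []) ℚ-ring)

<-gap-up-down : ∀ {c} x y p q → c < x - y → 0ℚ ≤ p + q → c < (x + q) - (y - p)
<-gap-up-down {c} x y p q c<gap 0≤p+q =
  <-by-slack (0<+ (<⇒0<- c<gap) 0≤p+q) (solve (c ∷ x ∷ y ∷ p ∷ q ∷ []) ℚ-ring)

0≤x≤t⇒∣x∣≤t : ∀ {x t} → 0ℚ ≤ x → x ≤ t → ∣ x ∣ ≤ t
0≤x≤t⇒∣x∣≤t 0≤x x≤t = subst (_≤ _) (sym (ℚ.0≤p⇒∣p∣≡p 0≤x)) x≤t

-t≤x≤0⇒∣x∣≤t : ∀ {x t} → - t ≤ x → x ≤ 0ℚ → ∣ x ∣ ≤ t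
-t≤x≤0⇒∣x∣≤t {x} {t} -t≤x x≤0 =
  subst (_≤ t) (sym (trans (sym (ℚ.∣-p∣≡∣p∣ x)) (ℚ.0≤p⇒∣p∣≡p (ℚ.neg-antimono-≤ x≤0))))
    (≤-by-slack (≤⇒0≤- -t≤x) (solve (x ∷ t ∷ []) ℚ-ring))

d≤dmax : ∀ (u v : ℕ → ℚ) n {i} → 1 ≤ℕ i → i ≤ℕ n → d u v i ≤ dmax u v n
d≤dmax u v zero (s≤s _) ()
d≤dmax u v (suc n) 1≤i i≤1+n with ℕ.m≤n⇒m<n∨m≡n i≤1+n
... | inj₁ i≤n  = ℚ.≤-trans (d≤dmax u v n 1≤i (ℕ.≤-pred i≤n)) (ℚ.p≤p⊔q _ _)
... | inj₂ refl = ℚ.p≤q⊔p (dmax u v n) (d u v (suc n))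

pat-suc : ∀ {s z w} i → z (suc i) ≡ w → pat s z (suc i) ≡ pat s z i + w
pat-suc _ refl = refl

gap-suc : ∀ {s s' z z' w w'} i → z (suc i) ≡ w → z' (suc i) ≡ w' →
          pat s z (suc i) - pat s' z' (suc i) ≡ (pat s z i + w) - (pat s' z' i + w')
gap-suc _ refl refl = refl

module GreedyPatterns {m : ℕ} {u v : ℕ → ℚ} {D δ : ℚ}
    (uv>0 : ∀ i → 1 ≤ℕ i → i ≤ℕ m → (0ℚ < u i) × (0ℚ < v i))
    (d≤D : ∀ i → 1 ≤ℕ i → i ≤ℕ m → d u v i ≤ D)
    (0≤δD/4 : 0ℚ ≤ ¼ * δ * D)
  where

  Forward Backward Greedy : ℚ → (ℕ → ℚ) → Set
  Forward  = IsForwardGreedy m u v D δ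
  Backward = IsBackwardGreedy m u v D δ
  Greedy   = IsGreedy m u v D δ

  private variable
    i j : ℕ
    s s' : ℚ
    z z' : ℕ → ℚ

  u>0 : suc i ≤ℕ m → 0ℚ < u (suc i)
  u>0 i<m = proj₁ (uv>0 _ (s≤s z≤n) i<m)

  v>0 : suc i ≤ℕ m → 0ℚ < v (suc i)
  v>0 i<m = proj₂ (uv>0 _ (s≤s z≤n) i<m)

  0≤d : suc i ≤ℕ m → 0ℚ ≤ u (suc i) + v (suc i)
  0≤d i<m = 0≤+ (ℚ.<⇒≤ (u>0 i<m)) (ℚ.<⇒≤ (v>0 i<m))

  solution : Greedy s z → IsSolution m u v z
  solution (inj₁ (sol , _)) = sol
  solution (inj₂ (sol , _)) = sol

  step : IsSolution m u v z → suc i ≤ℕ m → (z (suc i) ≡ v (suc i)) ⊎ (z (suc i) ≡ - u (suc i))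
  step sol = sol _ (s≤s z≤n)

  forward-up : Forward s z → suc i ≤ℕ m → z (suc i) ≡ v (suc i) →
               (pat s z i - u (suc i)) + (pat s z i + v (suc i)) ≤ D
  forward-up {s} {z} {i} (_ , _ , greedy) i<m up with greedy (suc i) (s≤s z≤n) i<m
  ... | range , nearest =
    upper-chosen⇒x+y≤D (x-p<x+q {pat s z i} (u>0 i<m) (v>0 i<m))
      (subst (_∈[ 0ℚ , D ]) (pat-suc i up) range)
      (subst (λ p → ∣ p - ½ * D ∣ ≤ ∣ (pat s z i + _) - ½ * D ∣) (pat-suc i up)
         ∘ nearest (- u (suc i)) (inj₂ refl))

  forward-down : Forward s z → suc i ≤ℕ m → z (suc i) ≡ - u (suc i) →
                 D ≤ (pat s z i - u (suc i)) + (pat s z i + v (suc i))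
  forward-down {s} {z} {i} (_ , _ , greedy) i<m down with greedy (suc i) (s≤s z≤n) i<m
  ... | range , nearest =
    lower-chosen⇒D≤x+y (x-p<x+q {pat s z i} (u>0 i<m) (v>0 i<m))
      (subst (_∈[ 0ℚ , D ]) (pat-suc i down) range)
      (subst (λ p → ∣ p - ½ * D ∣ ≤ ∣ (pat s z i + _) - ½ * D ∣) (pat-suc i down)
         ∘ nearest (v (suc i)) (inj₁ refl))

  backward-up : Backward s z → suc i ≤ℕ m → z (suc i) ≡ v (suc i) →
                D ≤ pat s z i + ((pat s z i + v (suc i)) - - u (suc i))
  backward-up {s} {z} {i} (_ , _ , greedy) i<m up =
    subst (_≤ _) (½D+½D≡D D) (lower-nearer⇒c+c≤x+y {c = ½ * D} (x<x+q-[-p] {pat s z i} (u>0 i<m) (v>0 i<m))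
      (subst (λ p → ∣ pat s z i - ½ * D ∣ ≤ ∣ (p - - u (suc i)) - ½ * D ∣) (pat-suc i up)
        (greedy (suc i) (s≤s z≤n) i<m (- u (suc i)) (inj₂ refl))))

  backward-down : Backward s z → suc i ≤ℕ m → z (suc i) ≡ - u (suc i) →
                  ((pat s z i - u (suc i)) - v (suc i)) + pat s z i ≤ D
  backward-down {s} {z} {i} (_ , _ , greedy) i<m down =
    subst (_ ≤_) (½D+½D≡D D) (upper-nearer⇒x+y≤c+c {c = ½ * D} (x-p-q<x {pat s z i} (u>0 i<m) (v>0 i<m))
      (subst (λ p → ∣ pat s z i - ½ * D ∣ ≤ ∣ (p - v (suc i)) - ½ * D ∣) (pat-suc i down)
        (greedy (suc i) (s≤s z≤n) i<m (v (suc i)) (inj₁ refl))))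

  band⊆range : ∀ {x} → x ∈[ ¼ * δ * D , (1ℚ - ¼ * δ) * D ] → x ∈[ 0ℚ , D ]
  band⊆range {x} (lo , hi) =
    ℚ.≤-trans 0≤δD/4 lo , ≤-by-slack (0≤+ (≤⇒0≤- hi) 0≤δD/4) (solve (x ∷ δ ∷ D ∷ []) ℚ-ring)

  forward-range : Forward s z → j ≤ℕ m → pat s z j ∈[ 0ℚ , D ]
  forward-range {j = zero}  (_ , band , _)   _   = band⊆range band
  forward-range {j = suc j} (_ , _ , greedy) j<m = proj₁ (greedy (suc j) (s≤s z≤n) j<m)

  backward-range : Backward s z → j ≤‴ m → pat s z j ∈[ 0ℚ , D ]
  backward-range (_ , band , _) ≤‴-refl = band⊆range band
  backward-range {s} {z} {j} B@(sol , _ , _) (≤‴-step j<‴m) with ℕ.≤‴⇒≤ j<‴m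
  ... | j<m with step sol j<m
  ...   | inj₁ up   = before-up (subst (_∈[ 0ℚ , D ]) (pat-suc j up) (backward-range B j<‴m))
                                (backward-up B j<m up) (v>0 j<m) (d≤D _ (s≤s z≤n) j<m)
    where
    before-up : ∀ {a p q} → (a + q) ∈[ 0ℚ , D ] → D ≤ a + ((a + q) - - p) → 0ℚ < q → p + q ≤ D →
                a ∈[ 0ℚ , D ]
    before-up {a} {p} {q} (_ , a+q≤D) h 0<q p+q≤D =
      ≤-by-double-slack (0≤+ (≤⇒0≤- h) (≤⇒0≤- p+q≤D)) (solve (a ∷ p ∷ q ∷ D ∷ []) ℚ-ring) ,
      ≤-by-slack (0≤+ (≤⇒0≤- a+q≤D) (ℚ.<⇒≤ 0<q)) (solve (a ∷ q ∷ D ∷ []) ℚ-ring)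
  ...   | inj₂ down = before-down (subst (_∈[ 0ℚ , D ]) (pat-suc j down) (backward-range B j<‴m))
                                  (backward-down B j<m down) (u>0 j<m) (d≤D _ (s≤s z≤n) j<m)
    where
    before-down : ∀ {a p q} → (a - p) ∈[ 0ℚ , D ] → ((a - p) - q) + a ≤ D → 0ℚ < p → p + q ≤ D →
                  a ∈[ 0ℚ , D ]
    before-down {a} {p} {q} (0≤a-p , _) h 0<p p+q≤D =
      ≤-by-slack (0≤+ 0≤a-p (ℚ.<⇒≤ 0<p)) (solve (a ∷ p ∷ []) ℚ-ring) ,
      ≤-by-double-slack (0≤+ (≤⇒0≤- h) (≤⇒0≤- p+q≤D)) (solve (a ∷ p ∷ q ∷ D ∷ []) ℚ-ring)

  greedy-range : Greedy s z → j ≤ℕ m → pat s z j ∈[ 0ℚ , D ]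
  greedy-range (inj₁ F) j≤m = forward-range F j≤m
  greedy-range (inj₂ B) j≤m = backward-range B (ℕ.≤⇒≤‴ j≤m)

  band-gap : ∀ {x x'} → x ≤ (1ℚ - ¼ * δ) * D → ¼ * δ * D ≤ x' → x - x' ≤ D - ½ * δ * D
  band-gap {x} {x'} hi lo' =
    ≤-by-slack (0≤+ (≤⇒0≤- hi) (≤⇒0≤- lo')) (solve (x ∷ x' ∷ δ ∷ D ∷ []) ℚ-ring)

  gap-same : ∀ j → z (suc j) ≡ z' (suc j) → pat s z (suc j) - pat s' z' (suc j) ≡ pat s z j - pat s' z' j
  gap-same {z} {z'} {s} {s'} j eq =
    trans (gap-suc j eq refl) ([x+w]-[y+w]≡x-y (pat s z j) (pat s' z' j) (z' (suc j)))

  Far : ℚ → (ℕ → ℚ) → ℚ → (ℕ → ℚ) → ℕ → Set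
  Far s z s' z' j = D - ½ * δ * D < pat s z j - pat s' z' j

  far-forward⇒close : Forward s z → Forward s' z' → j ≤ℕ m → Far s z s' z' j →
                      Close m (½ * δ * D) (pat s z) (pat s' z')
  far-forward⇒close {j = zero} (_ , (_ , hi) , _) (_ , (lo' , _) , _) _ far =
    ⊥-elim (<⇒≱ far (band-gap hi lo'))
  far-forward⇒close {s} {z} {s'} {z'} {suc j} F@(sol , _) F'@(sol' , _) j<m far
    with step sol j<m | step sol' j<m
  ... | inj₁ up   | inj₁ up'   = far-forward⇒close F F' (ℕ.<⇒≤ j<m)
                                   (subst (D - ½ * δ * D <_) (gap-same j (trans up (sym up'))) far)
  ... | inj₂ down | inj₂ down' = far-forward⇒close F F' (ℕ.<⇒≤ j<m)
                                   (subst (D - ½ * δ * D <_) (gap-same j (trans down (sym down'))) far)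
  ... | inj₂ down | inj₁ up'   = far-forward⇒close F F' (ℕ.<⇒≤ j<m)
                                   (<-gap-down-up (pat s z j) (pat s' z' j) (u (suc j)) (v (suc j))
                                     (subst (D - ½ * δ * D <_) (gap-suc j down up') far) (0≤d j<m))
  ... | inj₁ up   | inj₂ down' = j , ℕ.<⇒≤ j<m ,
    crossing (pat s z j) (pat s' z' j) (u (suc j)) (v (suc j))
      (forward-up F j<m up) (forward-down F' j<m down') (d≤D _ (s≤s z≤n) j<m)
      (subst (D - ½ * δ * D <_) (gap-suc j up down') far)
    where
    crossing : ∀ a a' p q → (a - p) + (a + q) ≤ D → D ≤ (a' - p) + (a' + q) → p + q ≤ D →
               D - ½ * δ * D < (a + q) - (a' - p) → ∣ a - a' ∣ ≤ ½ * δ * D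
    crossing a a' p q up-mid down-mid p+q≤D far =
      -t≤x≤0⇒∣x∣≤t
        (≤-by-slack (0≤+ (ℚ.<⇒≤ (<⇒0<- far)) (≤⇒0≤- p+q≤D)) (solve (a ∷ a' ∷ p ∷ q ∷ δ ∷ D ∷ []) ℚ-ring))
        (≤-by-double-slack (0≤+ (≤⇒0≤- up-mid) (≤⇒0≤- down-mid)) (solve (a ∷ a' ∷ p ∷ q ∷ D ∷ []) ℚ-ring))

  far-backward⇒close : Backward s z → Backward s' z' → j ≤‴ m → Far s z s' z' j →
                       Close m (½ * δ * D) (pat s z) (pat s' z')
  far-backward⇒close (_ , (_ , hi) , _) (_ , (lo' , _) , _) ≤‴-refl far =
    ⊥-elim (<⇒≱ far (band-gap hi lo'))
  far-backward⇒close {s} {z} {s'} {z'} {j} B@(sol , _) B'@(sol' , _) (≤‴-step j<‴m) far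
    with ℕ.≤‴⇒≤ j<‴m
  ... | j<m with step sol j<m | step sol' j<m
  ...   | inj₁ up   | inj₁ up'   = far-backward⇒close B B' j<‴m
                                     (subst (D - ½ * δ * D <_) (sym (gap-same j (trans up (sym up')))) far)
  ...   | inj₂ down | inj₂ down' = far-backward⇒close B B' j<‴m
                                     (subst (D - ½ * δ * D <_) (sym (gap-same j (trans down (sym down')))) far)
  ...   | inj₁ up   | inj₂ down' = far-backward⇒close B B' j<‴m
    (subst (D - ½ * δ * D <_) (sym (gap-suc j up down'))
      (<-gap-up-down (pat s z j) (pat s' z' j) (u (suc j)) (v (suc j)) far (0≤d j<m)))
  ...   | inj₂ down | inj₁ up'   = suc j , j<m ,
    subst (λ x → ∣ x ∣ ≤ ½ * δ * D) (sym (gap-suc j down up'))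
      (crossing (pat s z j) (pat s' z' j) (u (suc j)) (v (suc j))
        (backward-down B j<m down) (backward-up B' j<m up') (d≤D _ (s≤s z≤n) j<m) far)
    where
    crossing : ∀ a a' p q → ((a - p) - q) + a ≤ D → D ≤ a' + ((a' + q) - - p) → p + q ≤ D →
               D - ½ * δ * D < a - a' → ∣ (a - p) - (a' + q) ∣ ≤ ½ * δ * D
    crossing a a' p q down-mid up-mid p+q≤D far =
      -t≤x≤0⇒∣x∣≤t
        (≤-by-slack (0≤+ (ℚ.<⇒≤ (<⇒0<- far)) (≤⇒0≤- p+q≤D)) (solve (a ∷ a' ∷ p ∷ q ∷ δ ∷ D ∷ []) ℚ-ring))
        (≤-by-double-slack (0≤+ (≤⇒0≤- down-mid) (≤⇒0≤- up-mid)) (solve (a ∷ a' ∷ p ∷ q ∷ D ∷ []) ℚ-ring))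

  close-at : ∀ j → j ≤ℕ m → pat s' z' j ≤ pat s z j → pat s z j - pat s' z' j ≤ ½ * δ * D →
             Close m (½ * δ * D) (pat s z) (pat s' z')
  close-at j j≤m ord gap≤ε = j , j≤m , 0≤x≤t⇒∣x∣≤t (≤⇒0≤- ord) gap≤ε

  close-up-down : Greedy s z → Greedy s' z' → suc i ≤ℕ m → (1ℚ - δ) * D ≤ d u v (suc i) →
                  z (suc i) ≡ v (suc i) → z' (suc i) ≡ - u (suc i) → pat s' z' i ≤ pat s z i →
                  Close m (½ * δ * D) (pat s z) (pat s' z')
  close-up-down {s} {z} {s'} {z'} {i} (inj₁ F) G' i<m big up down' ord =
    close-at i (ℕ.<⇒≤ i<m) ord
      (up-forward (pat s z i) (pat s' z' i) (u (suc i)) (v (suc i)) (forward-up F i<m up)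
        (proj₁ (subst (_∈[ 0ℚ , D ]) (pat-suc i down') (greedy-range G' i<m))) big)
    where
    up-forward : ∀ a a' p q → (a - p) + (a + q) ≤ D → 0ℚ ≤ a' - p → (1ℚ - δ) * D ≤ p + q →
                 a - a' ≤ ½ * δ * D
    up-forward a a' p q up-mid 0≤a'-p big =
      ≤-by-double-slack (0≤+ (0≤+ (≤⇒0≤- up-mid) (0≤+ 0≤a'-p 0≤a'-p)) (≤⇒0≤- big))
        (solve (a ∷ a' ∷ p ∷ q ∷ δ ∷ D ∷ []) ℚ-ring)
  close-up-down {s} {z} {s'} {z'} {i} (inj₂ B) (inj₁ F') i<m big up down' ord =
    close-at i (ℕ.<⇒≤ i<m) ord
      (down-forward (pat s z i) (pat s' z' i) (u (suc i)) (v (suc i)) (forward-down F' i<m down')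
        (proj₂ (subst (_∈[ 0ℚ , D ]) (pat-suc i up) (backward-range B (ℕ.≤⇒≤‴ i<m)))) big)
    where
    down-forward : ∀ a a' p q → D ≤ (a' - p) + (a' + q) → a + q ≤ D → (1ℚ - δ) * D ≤ p + q →
                   a - a' ≤ ½ * δ * D
    down-forward a a' p q down-mid a+q≤D big =
      ≤-by-double-slack (0≤+ (0≤+ (≤⇒0≤- down-mid) (0≤+ (≤⇒0≤- a+q≤D) (≤⇒0≤- a+q≤D))) (≤⇒0≤- big))
        (solve (a ∷ a' ∷ p ∷ q ∷ δ ∷ D ∷ []) ℚ-ring)
  close-up-down {s} {z} {s'} {z'} {i} (inj₂ B) (inj₂ B') i<m big up down' ord
    with pat s z i - pat s' z' i ℚ.≤? ½ * δ * D
  ... | yes gap≤ε = close-at i (ℕ.<⇒≤ i<m) ord gap≤ε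
  ... | no  gap≰ε = far-backward⇒close B B' (ℕ.≤⇒≤‴ i<m)
    (subst (D - ½ * δ * D <_) (sym (gap-suc i up down'))
      (far-after (pat s z i) (pat s' z' i) (u (suc i)) (v (suc i)) (ℚ.≰⇒> gap≰ε) big))
    where
    far-after : ∀ a a' p q → ½ * δ * D < a - a' → (1ℚ - δ) * D ≤ p + q →
                D - ½ * δ * D < (a + q) - (a' - p)
    far-after a a' p q ε<gap big =
      <-by-slack (0<+ (<⇒0<- ε<gap) (≤⇒0≤- big)) (solve (a ∷ a' ∷ p ∷ q ∷ δ ∷ D ∷ []) ℚ-ring)

  close-down-up : Greedy s z → Greedy s' z' → suc i ≤ℕ m → (1ℚ - δ) * D ≤ d u v (suc i) →
                  z (suc i) ≡ - u (suc i) → z' (suc i) ≡ v (suc i) → pat s' z' (suc i) ≤ pat s z (suc i) →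
                  Close m (½ * δ * D) (pat s z) (pat s' z')
  close-down-up {s} {z} {s'} {z'} {i} (inj₂ B) G' i<m big down up' ord =
    close-at (suc i) i<m ord
      (subst (_≤ ½ * δ * D) (sym (gap-suc i down up'))
        (down-backward (pat s z i) (pat s' z' i) (u (suc i)) (v (suc i)) (backward-down B i<m down)
          (proj₁ (greedy-range G' (ℕ.<⇒≤ i<m))) big))
    where
    down-backward : ∀ a a' p q → ((a - p) - q) + a ≤ D → 0ℚ ≤ a' → (1ℚ - δ) * D ≤ p + q →
                    (a - p) - (a' + q) ≤ ½ * δ * D
    down-backward a a' p q down-mid 0≤a' big =
      ≤-by-double-slack (0≤+ (0≤+ (≤⇒0≤- down-mid) (0≤+ 0≤a' 0≤a')) (≤⇒0≤- big))
        (solve (a ∷ a' ∷ p ∷ q ∷ δ ∷ D ∷ []) ℚ-ring)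
  close-down-up {s} {z} {s'} {z'} {i} (inj₁ F) (inj₂ B') i<m big down up' ord =
    close-at (suc i) i<m ord
      (subst (_≤ ½ * δ * D) (sym (gap-suc i down up'))
        (up-backward (pat s z i) (pat s' z' i) (u (suc i)) (v (suc i)) (backward-up B' i<m up')
          (proj₂ (forward-range F (ℕ.<⇒≤ i<m))) big))
    where
    up-backward : ∀ a a' p q → D ≤ a' + ((a' + q) - - p) → a ≤ D → (1ℚ - δ) * D ≤ p + q →
                  (a - p) - (a' + q) ≤ ½ * δ * D
    up-backward a a' p q up-mid a≤D big =
      ≤-by-double-slack (0≤+ (0≤+ (≤⇒0≤- up-mid) (0≤+ (≤⇒0≤- a≤D) (≤⇒0≤- a≤D))) (≤⇒0≤- big))
        (solve (a ∷ a' ∷ p ∷ q ∷ δ ∷ D ∷ []) ℚ-ring)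
  close-down-up {s} {z} {s'} {z'} {i} (inj₁ F) (inj₁ F') i<m big down up' ord
    with pat s z (suc i) - pat s' z' (suc i) ℚ.≤? ½ * δ * D
  ... | yes gap≤ε = close-at (suc i) i<m ord gap≤ε
  ... | no  gap≰ε = far-forward⇒close F F' (ℕ.<⇒≤ i<m)
    (far-before (pat s z i) (pat s' z' i) (u (suc i)) (v (suc i))
      (subst (½ * δ * D <_) (gap-suc i down up') (ℚ.≰⇒> gap≰ε)) big)
    where
    far-before : ∀ a a' p q → ½ * δ * D < (a - p) - (a' + q) → (1ℚ - δ) * D ≤ p + q →
                 D - ½ * δ * D < a - a'
    far-before a a' p q ε<gap big =
      <-by-slack (0<+ (<⇒0<- ε<gap) (≤⇒0≤- big)) (solve (a ∷ a' ∷ p ∷ q ∷ δ ∷ D ∷ []) ℚ-ring)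

  close-at-opposite-step : Greedy s z → Greedy s' z' → suc i ≤ℕ m → (1ℚ - δ) * D ≤ d u v (suc i) →
                           z (suc i) ≢ z' (suc i) →
                           pat s' z' i ≤ pat s z i → pat s' z' (suc i) ≤ pat s z (suc i) →
                           Close m (½ * δ * D) (pat s z) (pat s' z')
  close-at-opposite-step G G' i<m big z≢z' ord ord-suc
    with step (solution G) i<m | step (solution G') i<m
  ... | inj₁ up   | inj₁ up'   = ⊥-elim (z≢z' (trans up (sym up')))
  ... | inj₂ down | inj₂ down' = ⊥-elim (z≢z' (trans down (sym down')))
  ... | inj₁ up   | inj₂ down' = close-up-down G G' i<m big up down' ord
  ... | inj₂ down | inj₁ up'   = close-down-up G G' i<m big down up' ord-suc

lemma8 : (m : ℕ) → 1 ≤ℕ m → (u v : ℕ → ℚ) →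
         (∀ i → 1 ≤ℕ i → i ≤ℕ m → (0ℚ < u i) × (0ℚ < v i)) →
         (δ : ℚ) → 0ℚ < δ → δ < ½ →
         (∀ i → 1 ≤ℕ i → i ≤ℕ m →
            (d u v i ∈[ 0ℚ , δ * dmax u v m ]) ⊎ (d u v i ∈[ (1ℚ - δ) * dmax u v m , dmax u v m ])) →
         (s s' : ℚ) (z z' : ℕ → ℚ) →
         IsGreedy m u v (dmax u v m) δ s z →
         IsGreedy m u v (dmax u v m) δ s' z' →
         (k : ℕ) → 1 ≤ℕ k → k ≤ℕ m →
         (1ℚ - δ) * dmax u v m ≤ d u v k →
         z k ≢ z' k →
         pat s' z' (k ∸ 1) ≤ pat s z (k ∸ 1) →
         pat s' z' k ≤ pat s z k →
         Close m (½ * δ * dmax u v m) (pat s z) (pat s' z')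
lemma8 m 1≤m u v uv>0 δ 0<δ _ _ s s' z z' G G' zero () _
lemma8 m 1≤m u v uv>0 δ 0<δ _ _ s s' z z' G G' (suc i) _ i<m big z≢z' ord ord-suc =
  close-at-opposite-step G G' i<m big z≢z' ord ord-suc
  where
  0≤D : 0ℚ ≤ dmax u v m
  0≤D = ℚ.≤-trans (0≤+ (ℚ.<⇒≤ (proj₁ (uv>0 1 (s≤s z≤n) 1≤m))) (ℚ.<⇒≤ (proj₂ (uv>0 1 (s≤s z≤n) 1≤m))))
                  (d≤dmax u v m (s≤s z≤n) 1≤m)
  open GreedyPatterns {δ = δ} uv>0 (λ _ → d≤dmax u v m) (0≤* (0≤* (ℚ.nonNegative⁻¹ ¼) (ℚ.<⇒≤ 0<δ)) 0≤D)
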